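{- Let $R$ be an integral domain of characteristic zero, let $n\ge 2$, and let $M=(m_{i,j})\in \operatorname{Frac}(R)^{n\times n}$ be a frieze matrix. Define the matrix $T_M=(t_{i,j})\in \operatorname{Frac}(R)^{n\times n}$ by \[ t_{i,j}=\begin{cases} m_{2,j} & \text{if } i=1,\\ m_{1,j} & \text{if } i=2,\\ 0 & \text{if } i\ge 3 \text{ and } j<i,\\ \dfrac{ -2m_{1,j}}{m_{1,i-1}}\,m_{i-1,i} & \text{if } i\ge 3 \text{ and } j\ge i.\end{cases} \] Then $M$ is row equivalent to the upper triangular matrix $T_M$, and $\det(T_M)=-\det(M)$.
   Context: A frieze matrix is a symmetric matrix $M=(m_{i,j})\in \operatorname{Frac}(R)^{n\times n}$ (with $\operatorname{Frac}(R)$ the field of fractions of $R$) such that $m_{i,j}=0$ if and only if $i=j$, and whose entries satisfy the generalized diamond rule \[ m_{i,j}m_{i+1,j+1}-m_{i+1,j}m_{i,j+1}=m_{i,i+1}m_{j,j+1} \] for all indices $1\le i$ and $j\ge i+1$ with $j+1\le n$. -}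

module Defs where

open import Level using (Level; _⊔_) renaming (suc to lsuc)
open import Data.Nat using (ℕ; zero; suc; _<_)
open import Data.Fin using (Fin; zero; suc; toℕ; inject₁; punchIn)
open import Data.Product using (Σ; _×_; ∃; _,_)
open import Relation.Nullary using (¬_; yes; no)
open import Relation.Binary.PropositionalEquality using (_≡_)
open import Algebra.Bundles using (CommutativeRing)
open import Algebra.Morphism.Structures using (module RingMorphisms)
open import Data.Nat.Properties using (_<?_; _≟_)
open import Data.Sum using (_⊎_)

record IsIntegralDomain {c ℓ} (R : CommutativeRing c ℓ) : Set (c ⊔ ℓ) where
  open CommutativeRing R
  field
    1≉0 : ¬ (1# ≈ 0#)
    noZeroDivisors : ∀ x y → x * y ≈ 0# → (x ≈ 0#) ⊎ (y ≈ 0#)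

natCast : ∀ {c ℓ} (R : CommutativeRing c ℓ) → ℕ → CommutativeRing.Carrier R
natCast R zero = CommutativeRing.0# R
natCast R (suc n) = CommutativeRing._+_ R (CommutativeRing.1# R) (natCast R n)

CharZero : ∀ {c ℓ} (R : CommutativeRing c ℓ) → Set ℓ
CharZero R = ∀ n → ¬ (CommutativeRing._≈_ R (natCast R (suc n)) (CommutativeRing.0# R))

-- The inverse is a total operation (value at 0 is
-- irrelevant), respecting the setoid equality.
record Field c ℓ : Set (lsuc (c ⊔ ℓ)) where
  field
    commutativeRing : CommutativeRing c ℓ
  open CommutativeRing commutativeRing public
  field
    _⁻¹ : Carrier → Carrier
    ⁻¹-cong : ∀ {x y} → x ≈ y → x ⁻¹ ≈ y ⁻¹
    ⁻¹-inverse : ∀ x → ¬ (x ≈ 0#) → x * (x ⁻¹) ≈ 1#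
    1≉0 : ¬ (1# ≈ 0#)

record IsFractionField {c ℓ c' ℓ'} (R : CommutativeRing c ℓ) (K : Field c' ℓ')
       (ι : CommutativeRing.Carrier R → Field.Carrier K) : Set (c ⊔ ℓ ⊔ c' ⊔ ℓ') where
  open RingMorphisms (CommutativeRing.rawRing R) (CommutativeRing.rawRing (Field.commutativeRing K))
  field
    isRingHomomorphism : IsRingHomomorphism ι
    injective : ∀ {a b} → Field._≈_ K (ι a) (ι b) → CommutativeRing._≈_ R a b
    fractions : ∀ x → Σ (CommutativeRing.Carrier R) λ a → Σ (CommutativeRing.Carrier R) λ b →
                  (¬ Field._≈_ K (ι b) (Field.0# K)) ×
                  Field._≈_ K x (Field._*_ K (ι a) (Field._⁻¹ K (ι b)))

module MatrixOver {c ℓ} (K : Field c ℓ) where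
  open Field K hiding (zero)

  Matrix : ℕ → Set c
  Matrix n = Fin n → Fin n → Carrier

  sumFin : ∀ {n} → (Fin n → Carrier) → Carrier
  sumFin {zero} f = 0#
  sumFin {suc n} f = f zero + sumFin (λ k → f (suc k))

  _⊗_ : ∀ {n} → Matrix n → Matrix n → Matrix n
  (A ⊗ B) i j = sumFin (λ k → A i k * B k j)

  identity : ∀ {n} → Matrix n
  identity i j with toℕ i ≟ toℕ j
  ... | yes _ = 1#
  ... | no _ = 0#

  _≋_ : ∀ {n} → Matrix n → Matrix n → Set ℓ
  A ≋ B = ∀ i j → A i j ≈ B i j

  signFin : ∀ {n} → Fin n → Carrier
  signFin zero = 1#
  signFin (suc i) = - signFin i

  det : ∀ {n} → Matrix n → Carrier
  det {zero} A = 1#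
  det {suc n} A = sumFin (λ i → signFin i * (A i zero * det (λ r s → A (punchIn i r) (suc s))))

  -- Row equivalence: B = P A for some invertible matrix P
  -- (equivalently, B is obtained from A by elementary row operations).
  RowEquivalent : ∀ {n} → Matrix n → Matrix n → Set (c ⊔ ℓ)
  RowEquivalent {n} A B = Σ (Matrix n) λ P → Σ (Matrix n) λ Q →
    ((P ⊗ Q) ≋ identity) × ((Q ⊗ P) ≋ identity) × ((P ⊗ A) ≋ B)

  record IsFrieze {n} (M : Matrix n) : Set ℓ where
    field
      symmetric : ∀ i j → M i j ≈ M j i
      zero⇒diag : ∀ i j → M i j ≈ 0# → i ≡ j
      diag⇒zero : ∀ i → M i i ≈ 0#
      diamond : ∀ (i j i' j' : Fin n) → toℕ i' ≡ suc (toℕ i) → toℕ j' ≡ suc (toℕ j) →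
                toℕ i < toℕ j →
                (M i j * M i' j') - (M i' j * M i j') ≈ M i i' * M j j'

  -- The matrix T_M (paper's 1-based rows 1,2,3,... are rows zero, suc zero, ... here).
  T : ∀ {k} → Matrix (suc (suc k)) → Matrix (suc (suc k))
  T M zero j = M (suc zero) j
  T M (suc zero) j = M zero j
  T M (suc (suc i')) j with toℕ j <? toℕ (suc (suc i'))
  ... | yes _ = 0#
  ... | no _ = ((- ((1# + 1#) * M zero j)) * (M zero (suc (inject₁ i')) ⁻¹))
               * M (suc (inject₁ i')) (suc (suc i'))

-- A frieze matrix is a matrix of 2 × 2 determinants: with v₁ = (1, 0), v₂ = (0, m₁,₂) and
-- vᵢ₊₂ = (mᵢ,ᵢ₊₂ vᵢ₊₁ − mᵢ₊₁,ᵢ₊₂ vᵢ) / mᵢ,ᵢ₊₁ in K², one has mₐ,b = det (vₐ, v_b) for a ≤ b,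
-- by induction on b − a: the diamond rule and the Plücker relation determine both sides in
-- the same way from the nearer diagonals.  Hence the entries satisfy the Ptolemy relations
-- mₐ,c m_b,d = mₐ,b m_c,d + mₐ,d m_b,c for a ≤ b ≤ c ≤ d, and these show that subtracting
-- (m₁,ᵢ / m₁,ᵢ₋₁) row (i − 1) and (mᵢ₋₁,ᵢ / m₁,ᵢ₋₁) row 1 from row i (i ≥ 3) produces
-- row i of T_M.  These additions of earlier rows, done from the bottom up, preserve the
-- determinant; exchanging rows 1 and 2 then gives T_M and the sign.

module Submission where

open import Algebra.Bundles using (CommutativeRing)
open import Algebra.Solver.Ring.AlmostCommutativeRing
  using (fromCommutativeRing; _-Raw-AlmostCommutative⟶_)
open import Data.Fin.Base using (Fin; zero; suc; toℕ; inject₁; punchIn; punchOut; fromℕ<)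
import Data.Fin.Base as Fin using (_<_; _≤_)
import Data.Fin.Properties as Fin
open import Data.Integer.Base as ℤ using (ℤ; +-*-rawRing)
open import Data.Integer.Properties using ([1+m]⊖[1+n]≡m⊖n) renaming (_≟_ to _≟ℤ_)
import Data.Maybe.Base as Maybe
open import Data.Nat.Base as ℕ using (ℕ; zero; suc; z≤n; s≤s)
import Data.Nat.Properties as ℕ
open import Data.Product.Base using (Σ; _×_; _,_; proj₁; proj₂)
import Data.Sign.Base as Sign
open import Data.Sum.Base using (_⊎_; inj₁; inj₂)
open import Data.Vec.Functional using (updateAt)
import Data.Vec.Functional.Properties as Vector
open import Level using (_⊔_)
open import Relation.Nullary.Decidable using (yes; no; dec⇒maybe)
open import Relation.Nullary.Negation using (¬_; contradiction)
open import Relation.Binary.Definitions using (tri<; tri≈; tri>)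
import Relation.Binary.PropositionalEquality as ≡
open import Relation.Binary.PropositionalEquality using (_≡_; _≢_)
open import Function.Base using (_∘_)

open import Defs

-- The
-- type-checking optimised multiples _×′_ make ℤcast (+ 1) reduce to 1# and ℤcast (+ 2) to 1# + 1#,
-- so that constants written with con match the ring's own 1# literally.
module IntegerCoefficientSolver {c ℓ} (R : CommutativeRing c ℓ) where
  open CommutativeRing R
  open import Data.Integer.Base using (+_; -[1+_]; _⊖_)
  open import Algebra.Properties.Semiring.Mult.TCOptimised semiring
    using (1+×; ×-homo-+; ×1-homo-*) renaming (_×_ to _×′_)
  open import Algebra.Properties.Ring ring
    using (-‿involutive; -0#≈0#; -‿distribˡ-*; -‿distribʳ-*; -‿+-comm)
  open import Algebra.Properties.Group +-group using (//-rightDividesʳ)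
  open import Algebra.Properties.CommutativeSemigroup +-commutativeSemigroup using (x∙yz≈y∙xz)

  ℤcast : ℤ → Carrier
  ℤcast (+ n) = n ×′ 1#
  ℤcast -[1+ n ] = - (suc n ×′ 1#)

  ⊖-+ : ∀ m n → ℤcast (m ⊖ n) + n ×′ 1# ≈ m ×′ 1#
  ⊖-+ zero zero = +-identityʳ 0#
  ⊖-+ zero (suc n) = -‿inverseˡ _
  ⊖-+ (suc m) zero = +-identityʳ _
  ⊖-+ (suc m) (suc n) = begin
    ℤcast (suc m ⊖ suc n) + suc n ×′ 1#
      ≈⟨ +-cong (reflexive (≡.cong ℤcast ([1+m]⊖[1+n]≡m⊖n m n))) (1+× n 1#) ⟩
    ℤcast (m ⊖ n) + (1# + n ×′ 1#)       ≈⟨ x∙yz≈y∙xz _ _ _ ⟩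
    1# + (ℤcast (m ⊖ n) + n ×′ 1#)       ≈⟨ +-congˡ (⊖-+ m n) ⟩
    1# + m ×′ 1#                         ≈⟨ sym (1+× m 1#) ⟩
    suc m ×′ 1#                          ∎
    where open import Relation.Binary.Reasoning.Setoid setoid

  ⊖-homo : ∀ m n → ℤcast (m ⊖ n) ≈ m ×′ 1# - n ×′ 1#
  ⊖-homo m n = trans (sym (//-rightDividesʳ (n ×′ 1#) (ℤcast (m ⊖ n)))) (+-congʳ (⊖-+ m n))

  +-homo : ∀ i j → ℤcast (i ℤ.+ j) ≈ ℤcast i + ℤcast j
  +-homo (+ m) (+ n) = ×-homo-+ 1# m n
  +-homo (+ m) -[1+ n ] = ⊖-homo m (suc n)
  +-homo -[1+ m ] (+ n) = trans (⊖-homo n (suc m)) (+-comm _ _)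
  +-homo -[1+ m ] -[1+ n ] = trans
    (-‿cong (trans (reflexive (≡.cong (λ l → suc l ×′ 1#) (≡.sym (ℕ.+-suc m n)))) (×-homo-+ 1# (suc m) (suc n))))
    (sym (-‿+-comm _ _))

  +◃-homo : ∀ n → ℤcast (Sign.+ ℤ.◃ n) ≈ n ×′ 1#
  +◃-homo zero = refl
  +◃-homo (suc n) = refl

  -◃-homo : ∀ n → ℤcast (Sign.- ℤ.◃ n) ≈ - (n ×′ 1#)
  -◃-homo zero = sym -0#≈0#
  -◃-homo (suc n) = refl

  *-homo : ∀ i j → ℤcast (i ℤ.* j) ≈ ℤcast i * ℤcast j
  *-homo (+ m) (+ n) = trans (+◃-homo (m ℕ.* n)) (×1-homo-* m n)
  *-homo (+ m) -[1+ n ] = trans (-◃-homo (m ℕ.* suc n)) (trans (-‿cong (×1-homo-* m (suc n))) (-‿distribʳ-* _ _))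
  *-homo -[1+ m ] (+ n) = trans (-◃-homo (suc m ℕ.* n)) (trans (-‿cong (×1-homo-* (suc m) n)) (-‿distribˡ-* _ _))
  *-homo -[1+ m ] -[1+ n ] = trans (+◃-homo (suc m ℕ.* suc n)) (trans (×1-homo-* (suc m) (suc n))
    (trans (sym (-‿involutive _)) (trans (-‿cong (-‿distribˡ-* _ _)) (-‿distribʳ-* _ _))))

  -‿homo : ∀ i → ℤcast (ℤ.- i) ≈ - ℤcast i
  -‿homo (+ zero) = sym -0#≈0#
  -‿homo (+ suc n) = refl
  -‿homo -[1+ n ] = sym (-‿involutive _)

  homomorphism : +-*-rawRing -Raw-AlmostCommutative⟶ fromCommutativeRing R
  homomorphism = record
    { ⟦_⟧ = ℤcast ; +-homo = +-homo ; *-homo = *-homo ; -‿homo = -‿homo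
    ; 0-homo = refl ; 1-homo = refl }

  open import Algebra.Solver.Ring +-*-rawRing (fromCommutativeRing R) homomorphism
    (λ i j → Maybe.map (λ i≡j → reflexive (≡.cong ℤcast i≡j)) (dec⇒maybe (i ≟ℤ j))) public

module Wedge {c ℓ} (R : CommutativeRing c ℓ) where
  open CommutativeRing R
  open IntegerCoefficientSolver R using (solve; _:=_; _:+_; _:*_; _:-_; con)

  Plane : Set c
  Plane = Carrier × Carrier

  wedge : Plane → Plane → Carrier
  wedge (x₁ , x₂) (y₁ , y₂) = x₁ * y₂ - x₂ * y₁

  wedge-self : ∀ x → wedge x x ≈ 0#
  wedge-self (x₁ , x₂) = solve 2 (λ x₁ x₂ → x₁ :* x₂ :- x₂ :* x₁ := con (ℤ.+ 0)) refl x₁ x₂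

  wedge-basis : ∀ x → wedge (1# , 0#) (0# , x) ≈ x
  wedge-basis = solve 1 (λ x → con (ℤ.+ 1) :* x :- con (ℤ.+ 0) :* con (ℤ.+ 0) := x) refl

  plücker : ∀ p q r s → wedge p r * wedge q s ≈ wedge p q * wedge r s + wedge p s * wedge q r
  plücker (p₁ , p₂) (q₁ , q₂) (r₁ , r₂) (s₁ , s₂) = solve 8 (λ p₁ p₂ q₁ q₂ r₁ r₂ s₁ s₂ →
    (p₁ :* r₂ :- p₂ :* r₁) :* (q₁ :* s₂ :- q₂ :* s₁) :=
    (p₁ :* q₂ :- p₂ :* q₁) :* (r₁ :* s₂ :- r₂ :* s₁) :+
    (p₁ :* s₂ :- p₂ :* s₁) :* (q₁ :* r₂ :- q₂ :* r₁))
    refl p₁ p₂ q₁ q₂ r₁ r₂ s₁ s₂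

  next : Carrier → Carrier → Carrier → Plane → Plane → Plane
  next u a b (y₁ , y₂) (x₁ , x₂) = u * (a * y₁ - b * x₁) , u * (a * y₂ - b * x₂)

  wedge-next₁ : ∀ u a b x y → wedge y (next u a b y x) ≈ (u * b) * wedge x y
  wedge-next₁ u a b (x₁ , x₂) (y₁ , y₂) = solve 7 (λ u a b x₁ x₂ y₁ y₂ →
    y₁ :* (u :* (a :* y₂ :- b :* x₂)) :- y₂ :* (u :* (a :* y₁ :- b :* x₁)) :=
    (u :* b) :* (x₁ :* y₂ :- x₂ :* y₁))
    refl u a b x₁ x₂ y₁ y₂

  wedge-next₀ : ∀ u a b x y → wedge x (next u a b y x) ≈ (u * a) * wedge x y
  wedge-next₀ u a b (x₁ , x₂) (y₁ , y₂) = solve 7 (λ u a b x₁ x₂ y₁ y₂ →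
    x₁ :* (u :* (a :* y₂ :- b :* x₂)) :- x₂ :* (u :* (a :* y₁ :- b :* x₁)) :=
    (u :* a) :* (x₁ :* y₂ :- x₂ :* y₁))
    refl u a b x₁ x₂ y₁ y₂

module FieldProperties {c ℓ} (K : Field c ℓ) where
  open Field K
  open import Relation.Binary.Reasoning.Setoid setoid

  ⁻¹-*-cancelʳ : ∀ {x} y → ¬ x ≈ 0# → (x ⁻¹ * y) * x ≈ y
  ⁻¹-*-cancelʳ {x} y x≉0 = begin
    (x ⁻¹ * y) * x  ≈⟨ *-congʳ (*-comm _ _) ⟩
    (y * x ⁻¹) * x  ≈⟨ *-assoc _ _ _ ⟩
    y * (x ⁻¹ * x)  ≈⟨ *-congˡ (trans (*-comm _ _) (⁻¹-inverse x x≉0)) ⟩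
    y * 1#          ≈⟨ *-identityʳ y ⟩
    y               ∎

  *-cancelʳ-nonzero : ∀ {x y z} → ¬ z ≈ 0# → x * z ≈ y * z → x ≈ y
  *-cancelʳ-nonzero {x} {y} {z} z≉0 xz≈yz = begin
    x                ≈⟨ ⁻¹-*-cancelʳ x z≉0 ⟨
    (z ⁻¹ * x) * z   ≈⟨ *-assoc _ _ _ ⟩
    z ⁻¹ * (x * z)   ≈⟨ *-congˡ xz≈yz ⟩
    z ⁻¹ * (y * z)   ≈⟨ *-assoc _ _ _ ⟨
    (z ⁻¹ * y) * z   ≈⟨ ⁻¹-*-cancelʳ y z≉0 ⟩
    y                ∎

module Matrices {c ℓ} (K : Field c ℓ) where
  open Field K hiding (zero)
  open MatrixOver K
  open IntegerCoefficientSolver commutativeRing using (solve; _:=_; _:+_; _:*_; :-_; con)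
  open import Algebra.Properties.Semiring.Sum semiring
    using (sum; sum-cong-≋; sum-cong-≗; sum-remove; sum-replicate-zero; ∑-distrib-+; ∑-comm;
           *-distribˡ-sum; *-distribʳ-sum)
  open import Algebra.Properties.Group +-group using (inverseˡ-unique)
  open import Algebra.Properties.Ring ring using (-‿involutive; -0#≈0#)
  open import Relation.Binary.Reasoning.Setoid setoid

  sumFin≡sum : ∀ {n} (f : Fin n → Carrier) → sumFin f ≡ sum f
  sumFin≡sum {zero} f = ≡.refl
  sumFin≡sum {suc n} f = ≡.cong (f zero +_) (sumFin≡sum (λ k → f (suc k)))

  sumFin-cong : ∀ {n} {f g : Fin n → Carrier} → (∀ i → f i ≈ g i) → sumFin f ≈ sumFin g
  sumFin-cong {f = f} {g} f≈g = begin
    sumFin f ≡⟨ sumFin≡sum f ⟩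
    sum f    ≈⟨ sum-cong-≋ f≈g ⟩
    sum g    ≡⟨ sumFin≡sum g ⟨
    sumFin g ∎

  sumFin-zero : ∀ {n} {f : Fin n → Carrier} → (∀ i → f i ≈ 0#) → sumFin f ≈ 0#
  sumFin-zero {n} {f} f≈0 = begin
    sumFin f ≡⟨ sumFin≡sum f ⟩
    sum f    ≈⟨ sum-cong-≋ f≈0 ⟩
    sum {n} (λ _ → 0#) ≈⟨ sum-replicate-zero n ⟩
    0#       ∎

  sumFin-linear : ∀ {n} {f g h : Fin n → Carrier} (x : Carrier) →
                  (∀ i → f i ≈ g i + x * h i) → sumFin f ≈ sumFin g + x * sumFin h
  sumFin-linear {f = f} {g} {h} x f≈g+xh = begin
    sumFin f                      ≡⟨ sumFin≡sum f ⟩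
    sum f                         ≈⟨ sum-cong-≋ f≈g+xh ⟩
    sum (λ i → g i + x * h i)     ≈⟨ ∑-distrib-+ g (λ i → x * h i) ⟩
    sum g + sum (λ i → x * h i)   ≈⟨ +-congˡ (*-distribˡ-sum x h) ⟨
    sum g + x * sum h             ≡⟨ ≡.cong₂ (λ a b → a + x * b) (sumFin≡sum g) (sumFin≡sum h) ⟨
    sumFin g + x * sumFin h       ∎

  sumFin-*ˡ : ∀ {n} (x : Carrier) (f : Fin n → Carrier) → x * sumFin f ≈ sumFin (λ i → x * f i)
  sumFin-*ˡ x f = begin
    x * sumFin f             ≡⟨ ≡.cong (x *_) (sumFin≡sum f) ⟩
    x * sum f                ≈⟨ *-distribˡ-sum x f ⟩
    sum (λ i → x * f i)      ≡⟨ sumFin≡sum (λ i → x * f i) ⟨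
    sumFin (λ i → x * f i)   ∎

  sumFin-*ʳ : ∀ {n} (x : Carrier) (f : Fin n → Carrier) → sumFin f * x ≈ sumFin (λ i → f i * x)
  sumFin-*ʳ x f = begin
    sumFin f * x             ≡⟨ ≡.cong (_* x) (sumFin≡sum f) ⟩
    sum f * x                ≈⟨ *-distribʳ-sum x f ⟩
    sum (λ i → f i * x)      ≡⟨ sumFin≡sum (λ i → f i * x) ⟨
    sumFin (λ i → f i * x)   ∎

  sumFin-comm : ∀ {m n} (g : Fin m → Fin n → Carrier) →
                sumFin (λ i → sumFin (λ j → g i j)) ≈ sumFin (λ j → sumFin (λ i → g i j))
  sumFin-comm g = begin
    sumFin (λ i → sumFin (g i))          ≡⟨ nested g ⟩
    sum (λ i → sum (g i))                ≈⟨ ∑-comm g ⟩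
    sum (λ j → sum (λ i → g i j))        ≡⟨ nested (λ j i → g i j) ⟨
    sumFin (λ j → sumFin (λ i → g i j))  ∎
    where
    nested : ∀ {m n} (h : Fin m → Fin n → Carrier) → sumFin (λ i → sumFin (h i)) ≡ sum (λ i → sum (h i))
    nested {m} h = ≡.trans (sumFin≡sum (λ i → sumFin (h i))) (sum-cong-≗ {m} (λ i → sumFin≡sum (h i)))

  identity-diag : ∀ {n} (i : Fin n) → identity i i ≈ 1#
  identity-diag i with toℕ i ℕ.≟ toℕ i
  ... | yes _ = refl
  ... | no i≢i = contradiction ≡.refl i≢i

  identity-offDiag : ∀ {n} {i j : Fin n} → i ≢ j → identity i j ≈ 0#
  identity-offDiag {i = i} {j} i≢j with toℕ i ℕ.≟ toℕ j
  ... | yes i≡j = contradiction (Fin.toℕ-injective i≡j) i≢j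
  ... | no _ = refl

  sumFin-identityˡ : ∀ {n} (i : Fin n) (f : Fin n → Carrier) → sumFin (λ k → identity i k * f k) ≈ f i
  sumFin-identityˡ {suc n} i f = begin
    sumFin δf                          ≡⟨ sumFin≡sum δf ⟩
    sum δf                             ≈⟨ sum-remove {i = i} δf ⟩
    δf i + sum (λ k → δf (punchIn i k)) ≈⟨ +-cong (trans (*-congʳ (identity-diag i)) (*-identityˡ (f i)))
                                                  (trans (sum-cong-≋ {n} off-i) (sum-replicate-zero n)) ⟩
    f i + 0#                           ≈⟨ +-identityʳ (f i) ⟩
    f i                                ∎
    where
    δf : Fin (suc n) → Carrier
    δf k = identity i k * f k
    off-i : ∀ k → δf (punchIn i k) ≈ 0#
    off-i k = trans (*-congʳ (identity-offDiag (λ eq → Fin.punchInᵢ≢i i k (≡.sym eq)))) (zeroˡ _)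

  ⊗-assoc : ∀ {n} (A B C : Matrix n) → ((A ⊗ B) ⊗ C) ≋ (A ⊗ (B ⊗ C))
  ⊗-assoc A B C i j = begin
    sumFin (λ k → sumFin (λ l → A i l * B l k) * C k j)
      ≈⟨ sumFin-cong (λ k → sumFin-*ʳ (C k j) (λ l → A i l * B l k)) ⟩
    sumFin (λ k → sumFin (λ l → A i l * B l k * C k j))
      ≈⟨ sumFin-comm (λ k l → A i l * B l k * C k j) ⟩
    sumFin (λ l → sumFin (λ k → A i l * B l k * C k j))
      ≈⟨ sumFin-cong (λ l → trans (sumFin-cong (λ k → *-assoc (A i l) (B l k) (C k j)))
                                  (sym (sumFin-*ˡ (A i l) (λ k → B l k * C k j)))) ⟩
    sumFin (λ l → A i l * sumFin (λ k → B l k * C k j))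
      ∎

  ⊗-congˡ : ∀ {n} {A A′ : Matrix n} (B : Matrix n) → A ≋ A′ → (A ⊗ B) ≋ (A′ ⊗ B)
  ⊗-congˡ B A≋A′ i j = sumFin-cong (λ k → *-congʳ (A≋A′ i k))

  ⊗-congʳ : ∀ {n} (A : Matrix n) {B B′ : Matrix n} → B ≋ B′ → (A ⊗ B) ≋ (A ⊗ B′)
  ⊗-congʳ A B≋B′ i j = sumFin-cong (λ k → *-congˡ (B≋B′ k j))

  identity-⊗ : ∀ {n} (A : Matrix n) → (identity ⊗ A) ≋ A
  identity-⊗ A i j = sumFin-identityˡ i (λ k → A k j)

  ≋-trans : ∀ {n} {A B C : Matrix n} → A ≋ B → B ≋ C → A ≋ C
  ≋-trans A≋B B≋C i j = trans (A≋B i j) (B≋C i j)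

  ⊗-inverse : ∀ {n} {P₁ Q₁ P₂ Q₂ : Matrix n} → (P₁ ⊗ Q₁) ≋ identity → (P₂ ⊗ Q₂) ≋ identity →
              ((P₂ ⊗ P₁) ⊗ (Q₁ ⊗ Q₂)) ≋ identity
  ⊗-inverse {P₁ = P₁} {Q₁} {P₂} {Q₂} P₁Q₁≋I P₂Q₂≋I =
    ≋-trans (⊗-assoc P₂ P₁ (Q₁ ⊗ Q₂))
    (≋-trans (⊗-congʳ P₂ (λ i j → sym (⊗-assoc P₁ Q₁ Q₂ i j)))
    (≋-trans (⊗-congʳ P₂ (≋-trans (⊗-congˡ Q₂ P₁Q₁≋I) (identity-⊗ Q₂))) P₂Q₂≋I))

  rowEquiv-refl : ∀ {n} (A : Matrix n) → RowEquivalent A A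
  rowEquiv-refl A = identity , identity , identity-⊗ identity , identity-⊗ identity , identity-⊗ A

  rowEquiv-trans : ∀ {n} {A B C : Matrix n} → RowEquivalent A B → RowEquivalent B C → RowEquivalent A C
  rowEquiv-trans {A = A} (P₁ , Q₁ , P₁Q₁ , Q₁P₁ , P₁A≋B) (P₂ , Q₂ , P₂Q₂ , Q₂P₂ , P₂B≋C) =
    P₂ ⊗ P₁ , Q₁ ⊗ Q₂ , ⊗-inverse P₁Q₁ P₂Q₂ , ⊗-inverse Q₂P₂ Q₁P₁ ,
    ≋-trans (⊗-assoc P₂ P₁ A) (≋-trans (⊗-congʳ P₂ P₁A≋B) P₂B≋C)

  rowEquiv-respʳ : ∀ {n} {A B C : Matrix n} → RowEquivalent A B → B ≋ C → RowEquivalent A C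
  rowEquiv-respʳ (P , Q , PQ , QP , PA≋B) B≋C = P , Q , PQ , QP , ≋-trans PA≋B B≋C

  SameRowsExcept : ∀ {n} → Fin n → Matrix n → Matrix n → Set ℓ
  SameRowsExcept r A B = ∀ i → i ≢ r → ∀ j → A i j ≈ B i j

  addRowMatrix : ∀ {n} → Fin n → Fin n → Carrier → Matrix n
  addRowMatrix r s x i k = identity i k + identity i r * (x * identity s k)

  addRowMatrix-⊗ : ∀ {n} (r s : Fin n) (x : Carrier) (A : Matrix n) i j →
                   (addRowMatrix r s x ⊗ A) i j ≈ A i j + identity i r * (x * A s j)
  addRowMatrix-⊗ r s x A i j = begin
    sumFin (λ k → (identity i k + identity i r * (x * identity s k)) * A k j)
      ≈⟨ sumFin-linear (identity i r) (λ k → distribute (identity i k) (identity i r) x (identity s k) (A k j)) ⟩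
    sumFin (λ k → identity i k * A k j) + identity i r * sumFin (λ k → x * (identity s k * A k j))
      ≈⟨ +-cong (sumFin-identityˡ i (λ k → A k j))
                (*-congˡ (trans (sym (sumFin-*ˡ x (λ k → identity s k * A k j)))
                                (*-congˡ (sumFin-identityˡ s (λ k → A k j))))) ⟩
    A i j + identity i r * (x * A s j) ∎
    where
    distribute : ∀ a e x b y → (a + e * (x * b)) * y ≈ a * y + e * (x * (b * y))
    distribute = solve 5 (λ a e x b y → (a :+ e :* (x :* b)) :* y := a :* y :+ e :* (x :* (b :* y))) refl

  addRowMatrix-inverse : ∀ {n} {r s : Fin n} {x y : Carrier} → s ≢ r → x + y ≈ 0# →
                         (addRowMatrix r s x ⊗ addRowMatrix r s y) ≋ identity
  addRowMatrix-inverse {r = r} {s} {x} {y} s≢r x+y≈0 i j = begin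
    (addRowMatrix r s x ⊗ E) i j                     ≈⟨ addRowMatrix-⊗ r s x E i j ⟩
    E i j + identity i r * (x * E s j)               ≈⟨ +-congˡ (*-congˡ (*-congˡ E-s)) ⟩
    E i j + identity i r * (x * identity s j)        ≈⟨ collect (identity i j) (identity i r) (identity s j) x y ⟩
    identity i j + identity i r * ((x + y) * identity s j)
                                                     ≈⟨ +-congˡ (*-congˡ (trans (*-congʳ x+y≈0) (zeroˡ _))) ⟩
    identity i j + identity i r * 0#                 ≈⟨ +-congˡ (zeroʳ _) ⟩
    identity i j + 0#                                ≈⟨ +-identityʳ _ ⟩
    identity i j                                     ∎
    where
    E = addRowMatrix r s y
    E-s : E s j ≈ identity s j
    E-s = trans (+-congˡ (trans (*-congʳ (identity-offDiag s≢r)) (zeroˡ _))) (+-identityʳ _)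
    collect : ∀ d e f x y → (d + e * (y * f)) + e * (x * f) ≈ d + e * ((x + y) * f)
    collect = solve 5 (λ d e f x y → (d :+ e :* (y :* f)) :+ e :* (x :* f) := d :+ e :* ((x :+ y) :* f)) refl

  rowEquiv-addRow : ∀ {n} {A B : Matrix n} {r s : Fin n} {x : Carrier} → s ≢ r →
                    SameRowsExcept r A B → (∀ j → B r j ≈ A r j + x * A s j) → RowEquivalent A B
  rowEquiv-addRow {A = A} {B} {r} {s} {x} s≢r same row-r =
    addRowMatrix r s x , addRowMatrix r s (- x) ,
    addRowMatrix-inverse s≢r (-‿inverseʳ x) , addRowMatrix-inverse s≢r (-‿inverseˡ x) , EA≋B
    where
    EA≋B : (addRowMatrix r s x ⊗ A) ≋ B
    EA≋B i j with i Fin.≟ r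
    ... | yes ≡.refl = trans (addRowMatrix-⊗ r s x A i j)
                        (trans (+-congˡ (trans (*-congʳ (identity-diag i)) (*-identityˡ _))) (sym (row-r j)))
    ... | no i≢r = trans (addRowMatrix-⊗ r s x A i j)
                     (trans (+-congˡ (trans (*-congʳ (identity-offDiag i≢r)) (zeroˡ _)))
                            (trans (+-identityʳ _) (same i i≢r j)))

  swap₀₁ : ∀ {n} → Fin (suc (suc n)) → Fin (suc (suc n))
  swap₀₁ zero = suc zero
  swap₀₁ (suc zero) = zero
  swap₀₁ (suc (suc i)) = suc (suc i)

  swap₀₁-involutive : ∀ {n} (i : Fin (suc (suc n))) → swap₀₁ (swap₀₁ i) ≡ i
  swap₀₁-involutive zero = ≡.refl
  swap₀₁-involutive (suc zero) = ≡.refl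
  swap₀₁-involutive (suc (suc i)) = ≡.refl

  rowEquiv-swap₀₁ : ∀ {n} {A B : Matrix (suc (suc n))} → (∀ i j → B i j ≈ A (swap₀₁ i) j) → RowEquivalent A B
  rowEquiv-swap₀₁ {A = A} B≈Aσ =
    S , S , SS≋I , SS≋I , λ i j → trans (sumFin-identityˡ (swap₀₁ i) (λ k → A k j)) (sym (B≈Aσ i j))
    where
    S : Matrix _
    S i k = identity (swap₀₁ i) k
    SS≋I : (S ⊗ S) ≋ identity
    SS≋I i j = trans (sumFin-identityˡ (swap₀₁ i) (λ k → S k j))
                     (reflexive (≡.cong (λ k → identity k j) (swap₀₁-involutive i)))

  minor : ∀ {n} → Matrix (suc n) → Fin (suc n) → Matrix n
  minor A i r s = A (punchIn i r) (suc s)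

  det-cong : ∀ {n} {A B : Matrix n} → A ≋ B → det A ≈ det B
  det-cong {zero} _ = refl
  det-cong {suc n} A≋B =
    sumFin-cong (λ i → *-congˡ {signFin i} (*-cong (A≋B i zero) (det-cong (λ r s → A≋B (punchIn i r) (suc s)))))

  minor-sameRows : ∀ {n} {A B : Matrix (suc n)} {r : Fin (suc n)} → SameRowsExcept r A B → minor A r ≋ minor B r
  minor-sameRows {r = r} A~B k s = A~B (punchIn r k) (Fin.punchInᵢ≢i r k) (suc s)

  minor-sameRowsExcept : ∀ {n} {A B : Matrix (suc n)} {r i : Fin (suc n)} (i≢r : i ≢ r) →
                         SameRowsExcept r A B → SameRowsExcept (punchOut i≢r) (minor A i) (minor B i)
  minor-sameRowsExcept {i = i} i≢r A~B k k≢r′ s = A~B (punchIn i k) punchIn≢r (suc s)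
    where
    punchIn≢r = λ eq → k≢r′ (Fin.punchIn-injective i k _ (≡.trans eq (≡.sym (Fin.punchIn-punchOut i≢r))))

  det-linear : ∀ {n} (A B C : Matrix n) (r : Fin n) (x : Carrier) →
               SameRowsExcept r A B → SameRowsExcept r A C →
               (∀ j → A r j ≈ B r j + x * C r j) → det A ≈ det B + x * det C
  det-linear {suc n} A B C r x A~B A~C row-r = sumFin-linear x expand
    where
    expand : ∀ i → signFin i * (A i zero * det (minor A i)) ≈
                   signFin i * (B i zero * det (minor B i)) + x * (signFin i * (C i zero * det (minor C i)))
    expand i with i Fin.≟ r
    ... | yes ≡.refl = begin
      σ * (A i zero * det (minor A i))                ≈⟨ *-congˡ (*-cong (row-r zero) (det-cong (minor-sameRows A~B))) ⟩
      σ * ((B i zero + x * C i zero) * det (minor B i)) ≈⟨ distribute σ (B i zero) x (C i zero) _ ⟩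
      σ * (B i zero * det (minor B i)) + x * (σ * (C i zero * det (minor B i)))
        ≈⟨ +-congˡ (*-congˡ (*-congˡ (*-congˡ (det-cong (λ k s →
             trans (sym (minor-sameRows A~B k s)) (minor-sameRows A~C k s)))))) ⟩
      σ * (B i zero * det (minor B i)) + x * (σ * (C i zero * det (minor C i))) ∎
      where
      σ = signFin i
      distribute : ∀ σ b x c d → σ * ((b + x * c) * d) ≈ σ * (b * d) + x * (σ * (c * d))
      distribute = solve 5 (λ σ b x c d → σ :* ((b :+ x :* c) :* d) := σ :* (b :* d) :+ x :* (σ :* (c :* d))) refl
    ... | no i≢r = begin
      σ * (A i zero * det (minor A i))                                       ≈⟨ *-congˡ (*-cong (A~B i i≢r zero) minors) ⟩
      σ * (B i zero * (det (minor B i) + x * det (minor C i)))               ≈⟨ distribute σ (B i zero) _ x _ ⟩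
      σ * (B i zero * det (minor B i)) + x * (σ * (B i zero * det (minor C i)))
        ≈⟨ +-congˡ (*-congˡ (*-congˡ (*-congʳ (trans (sym (A~B i i≢r zero)) (A~C i i≢r zero))))) ⟩
      σ * (B i zero * det (minor B i)) + x * (σ * (C i zero * det (minor C i))) ∎
      where
      σ = signFin i
      row-r′ : ∀ s → minor A i (punchOut i≢r) s ≈ minor B i (punchOut i≢r) s + x * minor C i (punchOut i≢r) s
      row-r′ s rewrite Fin.punchIn-punchOut i≢r = row-r (suc s)
      minors : det (minor A i) ≈ det (minor B i) + x * det (minor C i)
      minors = det-linear (minor A i) (minor B i) (minor C i) (punchOut i≢r) x
                 (minor-sameRowsExcept i≢r A~B) (minor-sameRowsExcept i≢r A~C) row-r′
      distribute : ∀ σ b d x e → σ * (b * (d + x * e)) ≈ σ * (b * d) + x * (σ * (b * e))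
      distribute = solve 5 (λ σ b d x e → σ :* (b :* (d :+ x :* e)) := σ :* (b :* d) :+ x :* (σ :* (b :* e))) refl

  inject₁≢suc : ∀ {n} (p : Fin n) → inject₁ p ≢ suc p
  inject₁≢suc zero ()
  inject₁≢suc (suc p) eq = inject₁≢suc p (Fin.suc-injective eq)

  signFin-inject₁ : ∀ {n} (p : Fin n) → signFin (inject₁ p) ≡ signFin p
  signFin-inject₁ zero = ≡.refl
  signFin-inject₁ (suc p) = ≡.cong -_ (signFin-inject₁ p)

  punchIn-adjacent : ∀ {n} (i : Fin (suc (suc n))) (p : Fin (suc n)) → i ≢ inject₁ p → i ≢ suc p →
                     Σ (Fin n) λ q → punchIn i (inject₁ q) ≡ inject₁ p × punchIn i (suc q) ≡ suc p
  punchIn-adjacent zero zero i≢p _ = contradiction ≡.refl i≢p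
  punchIn-adjacent zero (suc p) _ _ = p , ≡.refl , ≡.refl
  punchIn-adjacent (suc zero) zero _ i≢p+1 = contradiction ≡.refl i≢p+1
  punchIn-adjacent {suc n} (suc (suc i)) zero _ _ = zero , ≡.refl , ≡.refl
  punchIn-adjacent {suc n} (suc i) (suc p) i≢p i≢p+1
    with punchIn-adjacent i p (i≢p ∘ ≡.cong suc) (i≢p+1 ∘ ≡.cong suc)
  ... | q , eq₀ , eq₁ = suc q , ≡.cong suc eq₀ , ≡.cong suc eq₁

  punchIn-inject₁-suc : ∀ {n} (p k : Fin n) → punchIn (inject₁ p) k ≡ punchIn (suc p) k ⊎
                        (punchIn (inject₁ p) k ≡ suc p × punchIn (suc p) k ≡ inject₁ p)
  punchIn-inject₁-suc zero zero = inj₂ (≡.refl , ≡.refl)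
  punchIn-inject₁-suc zero (suc k) = inj₁ ≡.refl
  punchIn-inject₁-suc (suc p) zero = inj₁ ≡.refl
  punchIn-inject₁-suc (suc p) (suc k) with punchIn-inject₁-suc p k
  ... | inj₁ eq = inj₁ (≡.cong suc eq)
  ... | inj₂ (eq₀ , eq₁) = inj₂ (≡.cong suc eq₀ , ≡.cong suc eq₁)

  sumFin-adjacentCancel : ∀ {n} (f : Fin (suc n) → Carrier) (p : Fin n) → f (inject₁ p) + f (suc p) ≈ 0# →
                          (∀ i → i ≢ inject₁ p → i ≢ suc p → f i ≈ 0#) → sumFin f ≈ 0#
  sumFin-adjacentCancel {suc n} f zero pair≈0 others≈0 = begin
    f zero + (f (suc zero) + sumFin (λ i → f (suc (suc i)))) ≈⟨ +-assoc _ _ _ ⟨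
    (f zero + f (suc zero)) + sumFin (λ i → f (suc (suc i)))
      ≈⟨ +-cong pair≈0 (sumFin-zero (λ i → others≈0 (suc (suc i)) (λ ()) (λ ()))) ⟩
    0# + 0#                                                   ≈⟨ +-identityˡ 0# ⟩
    0#                                                        ∎
  sumFin-adjacentCancel {suc n} f (suc p) pair≈0 others≈0 = begin
    f zero + sumFin (λ i → f (suc i)) ≈⟨ +-cong (others≈0 zero (λ ()) (λ ()))
                                          (sumFin-adjacentCancel (λ i → f (suc i)) p pair≈0
                                            (λ i i≢p i≢p+1 → others≈0 (suc i) (i≢p ∘ Fin.suc-injective)
                                                                             (i≢p+1 ∘ Fin.suc-injective))) ⟩
    0# + 0#                           ≈⟨ +-identityˡ 0# ⟩
    0#                                ∎

  det-adjacentEqual : ∀ {n} (A : Matrix (suc n)) (p : Fin n) → (∀ j → A (inject₁ p) j ≈ A (suc p) j) → det A ≈ 0#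
  det-adjacentEqual {suc n} A p rows-equal = sumFin-adjacentCancel _ p pair-cancels others-vanish
    where
    minors-equal : minor A (inject₁ p) ≋ minor A (suc p)
    minors-equal k s with punchIn-inject₁-suc p k
    ... | inj₁ eq = reflexive (≡.cong (λ i → A i (suc s)) eq)
    ... | inj₂ (eq₀ , eq₁) rewrite eq₀ | eq₁ = sym (rows-equal (suc s))
    cancel : ∀ σ a d → σ * (a * d) + (- σ) * (a * d) ≈ 0#
    cancel = solve 3 (λ σ a d → σ :* (a :* d) :+ (:- σ) :* (a :* d) := con (ℤ.+ 0)) refl
    pair-cancels : signFin (inject₁ p) * (A (inject₁ p) zero * det (minor A (inject₁ p)))
                   + signFin (suc p) * (A (suc p) zero * det (minor A (suc p))) ≈ 0#
    pair-cancels rewrite signFin-inject₁ p =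
      trans (+-congˡ (*-congˡ (*-cong (sym (rows-equal zero)) (sym (det-cong minors-equal))))) (cancel _ _ _)
    others-vanish : ∀ i → i ≢ inject₁ p → i ≢ suc p → signFin i * (A i zero * det (minor A i)) ≈ 0#
    others-vanish i i≢p i≢p+1 with punchIn-adjacent i p i≢p i≢p+1
    ... | q , eq₀ , eq₁ = trans (*-congˡ (trans (*-congˡ minor-vanishes) (zeroʳ _))) (zeroʳ _)
      where
      minor-vanishes : det (minor A i) ≈ 0#
      minor-vanishes = det-adjacentEqual (minor A i) q (λ s → ≡.subst₂ (λ a b → A a (suc s) ≈ A b (suc s))
                                                                       (≡.sym eq₀) (≡.sym eq₁) (rows-equal (suc s)))

  infixl 30 _[_]≔_
  _[_]≔_ : ∀ {n} → Matrix n → Fin n → (Fin n → Carrier) → Matrix n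
  A [ r ]≔ u = updateAt A r (λ _ → u)

  replaceRow-at : ∀ {n} (A : Matrix n) r u j → (A [ r ]≔ u) r j ≡ u j
  replaceRow-at A r u j = ≡.cong (λ row → row j) (Vector.updateAt-updates r A)

  replaceRow-off : ∀ {n} (A : Matrix n) {r i} u j → i ≢ r → (A [ r ]≔ u) i j ≡ A i j
  replaceRow-off A {r} {i} u j i≢r = ≡.cong (λ row → row j) (Vector.updateAt-minimal i r A i≢r)

  replaceRow-sameRows : ∀ {n} (A : Matrix n) r u v → SameRowsExcept r (A [ r ]≔ u) (A [ r ]≔ v)
  replaceRow-sameRows A r u v i i≢r j = reflexive (≡.trans (replaceRow-off A u j i≢r) (≡.sym (replaceRow-off A v j i≢r)))

  replaceTwoRows-at₁ : ∀ {n} (A : Matrix n) {r s} u v j → (A [ r ]≔ u [ s ]≔ v) s j ≡ v j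
  replaceTwoRows-at₁ A {r} {s} u v j = replaceRow-at (A [ r ]≔ u) s v j

  replaceTwoRows-at₀ : ∀ {n} (A : Matrix n) {r s} u v j → r ≢ s → (A [ r ]≔ u [ s ]≔ v) r j ≡ u j
  replaceTwoRows-at₀ A {r} u v j r≢s = ≡.trans (replaceRow-off (A [ r ]≔ u) v j r≢s) (replaceRow-at A r u j)

  replaceTwoRows-off : ∀ {n} (A : Matrix n) {r s i} u v j → i ≢ r → i ≢ s → (A [ r ]≔ u [ s ]≔ v) i j ≡ A i j
  replaceTwoRows-off A {r} u v j i≢r i≢s = ≡.trans (replaceRow-off (A [ r ]≔ u) v j i≢s) (replaceRow-off A u j i≢r)

  det-replaceRow-+ : ∀ {n} (A : Matrix n) (r : Fin n) (u v : Fin n → Carrier) →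
                     det (A [ r ]≔ (λ j → u j + v j)) ≈ det (A [ r ]≔ u) + det (A [ r ]≔ v)
  det-replaceRow-+ A r u v = trans
    (det-linear _ _ _ r 1# (replaceRow-sameRows A r _ u) (replaceRow-sameRows A r _ v) row-r)
    (+-congˡ (*-identityˡ _))
    where
    row-r : ∀ j → (A [ r ]≔ (λ j → u j + v j)) r j ≈ (A [ r ]≔ u) r j + 1# * (A [ r ]≔ v) r j
    row-r j = begin
      (A [ r ]≔ (λ j → u j + v j)) r j ≡⟨ replaceRow-at A r _ j ⟩
      u j + v j                          ≈⟨ +-congˡ (*-identityˡ (v j)) ⟨
      u j + 1# * v j
        ≡⟨ ≡.cong₂ (λ a b → a + 1# * b) (replaceRow-at A r u j) (replaceRow-at A r v j) ⟨
      (A [ r ]≔ u) r j + 1# * (A [ r ]≔ v) r j ∎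

  replaceTwoRows-≋ : ∀ {n} {A C : Matrix n} {r s} (u v : Fin n → Carrier) → r ≢ s →
                     (∀ j → u j ≈ C r j) → (∀ j → v j ≈ C s j) →
                     (∀ i → i ≢ r → i ≢ s → ∀ j → A i j ≈ C i j) → (A [ r ]≔ u [ s ]≔ v) ≋ C
  replaceTwoRows-≋ {A = A} {r = r} {s} u v r≢s u≈ v≈ A≈ i j with i Fin.≟ s | i Fin.≟ r
  ... | yes ≡.refl | _ = trans (reflexive (replaceTwoRows-at₁ A {r} {s} u v j)) (v≈ j)
  ... | no i≢s | yes ≡.refl = trans (reflexive (replaceTwoRows-at₀ A u v j r≢s)) (u≈ j)
  ... | no i≢s | no i≢r = trans (reflexive (replaceTwoRows-off A u v j i≢r i≢s)) (A≈ i i≢r i≢s j)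

  det-replaceTwoRows-+ˡ : ∀ {n} (A : Matrix n) {r s} (u u′ v : Fin n → Carrier) → r ≢ s →
                          det (A [ r ]≔ (λ j → u j + u′ j) [ s ]≔ v) ≈
                          det (A [ r ]≔ u [ s ]≔ v) + det (A [ r ]≔ u′ [ s ]≔ v)
  det-replaceTwoRows-+ˡ A {r} {s} u u′ v r≢s = begin
    det (A [ r ]≔ (λ j → u j + u′ j) [ s ]≔ v)                ≈⟨ det-cong (commute _) ⟩
    det (A [ s ]≔ v [ r ]≔ (λ j → u j + u′ j))                ≈⟨ det-replaceRow-+ (A [ s ]≔ v) r u u′ ⟩
    det (A [ s ]≔ v [ r ]≔ u) + det (A [ s ]≔ v [ r ]≔ u′)
      ≈⟨ +-cong (det-cong (commute u)) (det-cong (commute u′)) ⟨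
    det (A [ r ]≔ u [ s ]≔ v) + det (A [ r ]≔ u′ [ s ]≔ v)    ∎
    where
    commute : ∀ w → (A [ r ]≔ w [ s ]≔ v) ≋ (A [ s ]≔ v [ r ]≔ w)
    commute w i j = reflexive (≡.cong (λ row → row j) (Vector.updateAt-commutes s r (r≢s ∘ ≡.sym) A i))

  -- D u v, the determinant with rows p, p + 1 replaced by u, v, is bilinear and vanishes for u = v,
  -- so 0 = D (x + y) (x + y) = D x y + D y x.
  det-swapAdjacent : ∀ {n} (A B : Matrix (suc n)) (p : Fin n) →
                     (∀ i → i ≢ inject₁ p → i ≢ suc p → ∀ j → A i j ≈ B i j) →
                     (∀ j → A (suc p) j ≈ B (inject₁ p) j) → (∀ j → A (inject₁ p) j ≈ B (suc p) j) →
                     det B ≈ - det A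
  det-swapAdjacent {n} A B p A~B A₁≈B₀ A₀≈B₁ = inverseˡ-unique (det B) (det A) (sym (begin
    0#                                                  ≈⟨ D-diag (x +ᵣ y) ⟨
    D (x +ᵣ y) (x +ᵣ y)                                 ≈⟨ det-replaceRow-+ (A [ i₀ ]≔ (x +ᵣ y)) i₁ x y ⟩
    D (x +ᵣ y) x + D (x +ᵣ y) y                         ≈⟨ +-cong (det-replaceTwoRows-+ˡ A x y x i₀≢i₁)
                                                                  (det-replaceTwoRows-+ˡ A x y y i₀≢i₁) ⟩
    (D x x + D y x) + (D x y + D y y)                   ≈⟨ +-cong (+-cong (D-diag x) D-B) (+-cong D-A (D-diag y)) ⟩
    (0# + det B) + (det A + 0#)                         ≈⟨ +-cong (+-identityˡ _) (+-identityʳ _) ⟩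
    det B + det A                                       ∎))
    where
    i₀ i₁ : Fin (suc n)
    i₀ = inject₁ p
    i₁ = suc p
    i₀≢i₁ = inject₁≢suc p
    x y : Fin (suc n) → Carrier
    x = A i₀
    y = A i₁
    _+ᵣ_ : (Fin (suc n) → Carrier) → (Fin (suc n) → Carrier) → Fin (suc n) → Carrier
    (u +ᵣ v) j = u j + v j
    D : (Fin (suc n) → Carrier) → (Fin (suc n) → Carrier) → Carrier
    D u v = det (A [ i₀ ]≔ u [ i₁ ]≔ v)
    D-diag : ∀ u → D u u ≈ 0#
    D-diag u = det-adjacentEqual (A [ i₀ ]≔ u [ i₁ ]≔ u) p (λ j → reflexive (≡.trans
      (replaceTwoRows-at₀ A u u j i₀≢i₁) (≡.sym (replaceTwoRows-at₁ A {i₀} {i₁} u u j))))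
    D-A : D x y ≈ det A
    D-A = det-cong (replaceTwoRows-≋ x y i₀≢i₁ (λ _ → refl) (λ _ → refl) (λ _ _ _ _ → refl))
    D-B : D y x ≈ det B
    D-B = det-cong (replaceTwoRows-≋ y x i₀≢i₁ A₁≈B₀ A₀≈B₁ A~B)

  det-swap₀₁ : ∀ {n} {A B : Matrix (suc (suc n))} → (∀ i j → B i j ≈ A (swap₀₁ i) j) → det B ≈ - det A
  det-swap₀₁ {A = A} {B} B≈Aσ =
    det-swapAdjacent A B zero A~B (λ j → sym (B≈Aσ zero j)) (λ j → sym (B≈Aσ (suc zero) j))
    where
    A~B : ∀ i → i ≢ zero → i ≢ suc zero → ∀ j → A i j ≈ B i j
    A~B zero i≢0 _ = contradiction ≡.refl i≢0
    A~B (suc zero) _ i≢1 = contradiction ≡.refl i≢1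
    A~B (suc (suc i)) _ _ j = sym (B≈Aσ (suc (suc i)) j)

  det-equalRows< : ∀ {n} t (A : Matrix n) {p q : Fin n} → toℕ q ≡ t → p Fin.< q →
                   (∀ j → A p j ≈ A q j) → det A ≈ 0#
  det-equalRows< zero A {q = suc q} () p<q rows
  det-equalRows< (suc t) A {p} {suc q} q≡t p<q rows with p Fin.≟ inject₁ q
  ... | yes ≡.refl = det-adjacentEqual A q rows
  ... | no p≢q₀ = begin
    det A         ≈⟨ -‿involutive (det A) ⟨
    - (- det A)   ≈⟨ -‿cong det-swapped ⟨
    - det B       ≈⟨ -‿cong (det-equalRows< t B q₀≡t p<q₀ rowsB) ⟩
    - 0#          ≈⟨ -0#≈0# ⟩
    0#            ∎
    where
    q₀ = inject₁ q
    B : Matrix _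
    B = A [ q₀ ]≔ A (suc q) [ suc q ]≔ A q₀
    det-swapped : det B ≈ - det A
    det-swapped = det-swapAdjacent A B q
      (λ i i≢q₀ i≢q j → sym (reflexive (replaceTwoRows-off A _ _ j i≢q₀ i≢q)))
      (λ j → sym (reflexive (replaceTwoRows-at₀ A _ _ j (inject₁≢suc q))))
      (λ j → sym (reflexive (replaceTwoRows-at₁ A {q₀} {suc q} _ _ j)))
    q₀≡t : toℕ q₀ ≡ t
    q₀≡t = ≡.trans (Fin.toℕ-inject₁ q) (ℕ.suc-injective q≡t)
    p<q₀ : p Fin.< q₀
    p<q₀ = ≡.subst (toℕ p ℕ.<_) (≡.sym (Fin.toℕ-inject₁ q))
             (ℕ.≤∧≢⇒< (ℕ.s≤s⁻¹ p<q)
                      (λ eq → p≢q₀ (Fin.toℕ-injective (≡.trans eq (≡.sym (Fin.toℕ-inject₁ q))))))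
    p≢q+1 : p ≢ suc q
    p≢q+1 eq = ℕ.<-irrefl (≡.cong toℕ eq) p<q
    rowsB : ∀ j → B p j ≈ B q₀ j
    rowsB j = begin
      B p j          ≡⟨ replaceTwoRows-off A _ _ j p≢q₀ p≢q+1 ⟩
      A p j          ≈⟨ rows j ⟩
      A (suc q) j    ≡⟨ replaceTwoRows-at₀ A _ _ j (inject₁≢suc q) ⟨
      B q₀ j         ∎

  det-equalRows : ∀ {n} (A : Matrix n) {p q : Fin n} → p ≢ q → (∀ j → A p j ≈ A q j) → det A ≈ 0#
  det-equalRows A {p} {q} p≢q rows with Fin.<-cmp p q
  ... | tri< p<q _ _ = det-equalRows< (toℕ q) A ≡.refl p<q rows
  ... | tri≈ _ p≡q _ = contradiction p≡q p≢q
  ... | tri> _ _ q<p = det-equalRows< (toℕ p) A ≡.refl q<p (λ j → sym (rows j))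

  det-addRow : ∀ {n} {A B : Matrix n} {r s : Fin n} {x : Carrier} → s ≢ r →
               SameRowsExcept r A B → (∀ j → B r j ≈ A r j + x * A s j) → det B ≈ det A
  det-addRow {A = A} {B} {r} {s} {x} s≢r same row-r = begin
    det B                    ≈⟨ det-linear B A C r x (λ i i≢r j → sym (same i i≢r j)) B~C row-r′ ⟩
    det A + x * det C        ≈⟨ +-congˡ (*-congˡ (det-equalRows C (s≢r ∘ ≡.sym) rows-r-s)) ⟩
    det A + x * 0#           ≈⟨ +-congˡ (zeroʳ x) ⟩
    det A + 0#               ≈⟨ +-identityʳ (det A) ⟩
    det A                    ∎
    where
    C = A [ r ]≔ A s
    B~C : SameRowsExcept r B C
    B~C i i≢r j = trans (sym (same i i≢r j)) (sym (reflexive (replaceRow-off A _ j i≢r)))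
    row-r′ : ∀ j → B r j ≈ A r j + x * C r j
    row-r′ j = trans (row-r j) (+-congˡ (*-congˡ (sym (reflexive (replaceRow-at A r (A s) j)))))
    rows-r-s : ∀ j → C r j ≈ C s j
    rows-r-s j = reflexive (≡.trans (replaceRow-at A r (A s) j) (≡.sym (replaceRow-off A _ j s≢r)))

  SpecialRowEquivalent : ∀ {n} → Matrix n → Matrix n → Set (c ⊔ ℓ)
  SpecialRowEquivalent A B = RowEquivalent A B × det B ≈ det A

  special-≋ : ∀ {n} {A B : Matrix n} → A ≋ B → SpecialRowEquivalent A B
  special-≋ {A = A} A≋B = rowEquiv-respʳ (rowEquiv-refl A) A≋B , det-cong (λ i j → sym (A≋B i j))

  special-trans : ∀ {n} {A B C : Matrix n} →
                  SpecialRowEquivalent A B → SpecialRowEquivalent B C → SpecialRowEquivalent A C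
  special-trans (A~B , detB≈detA) (B~C , detC≈detB) = rowEquiv-trans A~B B~C , trans detC≈detB detB≈detA

  special-addRow : ∀ {n} {A B : Matrix n} {r s : Fin n} {x : Carrier} → s ≢ r →
                   SameRowsExcept r A B → (∀ j → B r j ≈ A r j + x * A s j) → SpecialRowEquivalent A B
  special-addRow s≢r same row-r = rowEquiv-addRow s≢r same row-r , det-addRow s≢r same row-r

  special-addTwoRows : ∀ {n} {A B : Matrix n} {r p q : Fin n} {a b : Carrier} → p ≢ r → q ≢ r →
                       SameRowsExcept r A B → (∀ j → B r j ≈ A r j + a * A p j + b * A q j) →
                       SpecialRowEquivalent A B
  special-addTwoRows {A = A} {B} {r} {p} {q} {a} {b} p≢r q≢r same row-r =
    special-trans (special-addRow p≢r A~C (λ j → reflexive (replaceRow-at A r _ j)))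
                  (special-addRow q≢r C~B row-r′)
    where
    C = A [ r ]≔ (λ j → A r j + a * A p j)
    A~C : SameRowsExcept r A C
    A~C i i≢r j = sym (reflexive (replaceRow-off A _ j i≢r))
    C~B : SameRowsExcept r C B
    C~B i i≢r j = trans (reflexive (replaceRow-off A _ j i≢r)) (same i i≢r j)
    row-r′ : ∀ j → B r j ≈ C r j + b * C q j
    row-r′ j = trans (row-r j)
      (sym (+-cong (reflexive (replaceRow-at A r _ j)) (*-congˡ (reflexive (replaceRow-off A _ j q≢r)))))

  record AddsRowsAbove {n} (A B : Matrix n) (r : Fin n) : Set (c ⊔ ℓ) where
    field
      p q : Fin n
      p<r : p Fin.< r
      q<r : q Fin.< r
      a b : Carrier
      row : ∀ j → B r j ≈ A r j + a * A p j + b * A q j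

  splice : ∀ {n} → ℕ → Matrix n → Matrix n → Matrix n
  splice t A B i with toℕ i ℕ.<? t
  ... | yes _ = A i
  ... | no _ = B i

  splice-above : ∀ {n t} (A B : Matrix n) i → toℕ i ℕ.< t → ∀ j → splice t A B i j ≈ A i j
  splice-above {t = t} A B i i<t j with toℕ i ℕ.<? t
  ... | yes _ = refl
  ... | no i≮t = contradiction i<t i≮t

  splice-below : ∀ {n t} (A B : Matrix n) i → ¬ toℕ i ℕ.< t → ∀ j → splice t A B i j ≈ B i j
  splice-below {t = t} A B i i≮t j with toℕ i ℕ.<? t
  ... | yes i<t = contradiction i<t i≮t
  ... | no _ = refl

  splice-off : ∀ {n t} (A B : Matrix n) i → toℕ i ≢ t → ∀ j → splice (suc t) A B i j ≈ splice t A B i j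
  splice-off {t = t} A B i i≢t j with toℕ i ℕ.<? suc t | toℕ i ℕ.<? t
  ... | yes _ | yes _ = refl
  ... | no _ | no _ = refl
  ... | yes i<1+t | no i≮t = contradiction (ℕ.≤∧≢⇒< (ℕ.s≤s⁻¹ i<1+t) i≢t) i≮t
  ... | no i≮1+t | yes i<t = contradiction (ℕ.m<n⇒m<1+n i<t) i≮1+t

  -- Performed from the bottom row upwards, each row addition only involves rows not yet changed.
  special-addRowsAbove : ∀ {n} {A B : Matrix n} → (∀ r → (∀ j → A r j ≈ B r j) ⊎ AddsRowsAbove A B r) →
                         SpecialRowEquivalent A B
  special-addRowsAbove {n} {A} {B} rows =
    special-trans (special-≋ A≋top) (special-trans (reduce n ℕ.≤-refl) (special-≋ bottom≋B))
    where
    partial : ℕ → Matrix n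
    partial t = splice t A B

    step : ∀ t (r : Fin n) → toℕ r ≡ t → SpecialRowEquivalent (partial (suc t)) (partial t)
    step t r ≡.refl with rows r
    ... | inj₁ A≈B = special-≋ P≋P
      where
      P≋P : partial (suc t) ≋ partial t
      P≋P i j with i Fin.≟ r
      ... | yes ≡.refl =
        trans (splice-above A B i (ℕ.n<1+n _) j) (trans (A≈B j) (sym (splice-below A B i (ℕ.<-irrefl ≡.refl) j)))
      ... | no i≢r = splice-off A B i (i≢r ∘ Fin.toℕ-injective) j
    ... | inj₂ adds = special-addTwoRows (ℕ.<⇒≢ p<r ∘ ≡.cong toℕ) (ℕ.<⇒≢ q<r ∘ ≡.cong toℕ) same row-r
      where
      open AddsRowsAbove adds
      same : SameRowsExcept r (partial (suc t)) (partial t)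
      same i i≢r = splice-off A B i (i≢r ∘ Fin.toℕ-injective)
      row-r : ∀ j → partial t r j ≈ partial (suc t) r j + a * partial (suc t) p j + b * partial (suc t) q j
      row-r j = trans (splice-below A B r (ℕ.<-irrefl ≡.refl) j)
        (trans (row j) (sym (+-cong (+-cong (splice-above A B r (ℕ.n<1+n _) j)
                                            (*-congˡ (splice-above A B p (ℕ.m<n⇒m<1+n p<r) j)))
                                   (*-congˡ (splice-above A B q (ℕ.m<n⇒m<1+n q<r) j)))))

    reduce : ∀ t → t ℕ.≤ n → SpecialRowEquivalent (partial t) (partial 0)
    reduce zero _ = special-≋ (λ _ _ → refl)
    reduce (suc t) t<n = special-trans (step t (fromℕ< t<n) (Fin.toℕ-fromℕ< t<n)) (reduce t (ℕ.<⇒≤ t<n))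

    A≋top : A ≋ partial n
    A≋top i j = sym (splice-above A B i (Fin.toℕ<n i) j)

    bottom≋B : partial 0 ≋ B
    bottom≋B i = splice-below {t = 0} A B i λ ()

module FriezeMatrix {c ℓ} (K : Field c ℓ) (k : ℕ) (M : MatrixOver.Matrix K (suc (suc k)))
                    (frieze : MatrixOver.IsFrieze K M) where
  open Field K hiding (zero)
  open MatrixOver K
  open IsFrieze frieze
  open Wedge commutativeRing
  open FieldProperties K
  open Matrices K using (AddsRowsAbove; swap₀₁)
  open IntegerCoefficientSolver commutativeRing using (solve; _:=_; _:+_; _:*_; _:-_; :-_; con)
  open import Algebra.Properties.Group +-group using (∙-cancelˡ; //-rightDividesˡ)
  open import Relation.Binary.Reasoning.Setoid setoid

  N : ℕ
  N = suc (suc k)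

  -- junk value 0# outside the matrix
  m : ℕ → ℕ → Carrier
  m a b with a ℕ.<? N | b ℕ.<? N
  ... | yes a<N | yes b<N = M (fromℕ< a<N) (fromℕ< b<N)
  ... | _ | _ = 0#

  m-toℕ : ∀ (x y : Fin N) → m (toℕ x) (toℕ y) ≈ M x y
  m-toℕ x y with toℕ x ℕ.<? N | toℕ y ℕ.<? N
  ... | yes x<N | yes y<N = reflexive (≡.cong₂ M (Fin.fromℕ<-toℕ x x<N) (Fin.fromℕ<-toℕ y y<N))
  ... | no x≮N | _ = contradiction (Fin.toℕ<n x) x≮N
  ... | yes _ | no y≮N = contradiction (Fin.toℕ<n y) y≮N

  m-fromℕ< : ∀ {a b} (a<N : a ℕ.< N) (b<N : b ℕ.< N) → m a b ≈ M (fromℕ< a<N) (fromℕ< b<N)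
  m-fromℕ< a<N b<N = trans (reflexive (≡.sym (≡.cong₂ m (Fin.toℕ-fromℕ< a<N) (Fin.toℕ-fromℕ< b<N)))) (m-toℕ _ _)

  m-diag : ∀ {a} → a ℕ.< N → m a a ≈ 0#
  m-diag a<N = trans (m-fromℕ< a<N a<N) (diag⇒zero _)

  m-nonzero : ∀ {a b} → a ℕ.< N → b ℕ.< N → a ≢ b → ¬ m a b ≈ 0#
  m-nonzero a<N b<N a≢b mab≈0 = a≢b (≡.trans (≡.sym (Fin.toℕ-fromℕ< a<N))
    (≡.trans (≡.cong toℕ (zero⇒diag _ _ (trans (sym (m-fromℕ< a<N b<N)) mab≈0))) (Fin.toℕ-fromℕ< b<N)))

  m-diamond : ∀ {a j} → a ℕ.< j → suc j ℕ.< N →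
              m a j * m (suc a) (suc j) ≈ m a (suc a) * m j (suc j) + m a (suc j) * m (suc a) j
  m-diamond {a} {j} a<j j+1<N = begin
    m a j * m (suc a) (suc j)                                  ≈⟨ //-rightDividesˡ _ _ ⟨
    (m a j * m (suc a) (suc j) - y) + y                        ≈⟨ +-cong diamond′ (*-comm _ _) ⟩
    m a (suc a) * m j (suc j) + m a (suc j) * m (suc a) j     ∎
    where
    y = m (suc a) j * m a (suc j)
    j<N = ℕ.<-trans (ℕ.n<1+n j) j+1<N
    a+1<N = ℕ.≤-<-trans a<j j<N
    a<N = ℕ.<-trans (ℕ.n<1+n a) a+1<N
    A = fromℕ< a<N ; A′ = fromℕ< a+1<N ; J = fromℕ< j<N ; J′ = fromℕ< j+1<N
    toℕ-succ : ∀ {b} (b<N : b ℕ.< N) (b+1<N : suc b ℕ.< N) → toℕ (fromℕ< b+1<N) ≡ suc (toℕ (fromℕ< b<N))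
    toℕ-succ b<N b+1<N = ≡.trans (Fin.toℕ-fromℕ< b+1<N) (≡.cong suc (≡.sym (Fin.toℕ-fromℕ< b<N)))
    diamond′ : m a j * m (suc a) (suc j) - y ≈ m a (suc a) * m j (suc j)
    diamond′ = begin
      m a j * m (suc a) (suc j) - m (suc a) j * m a (suc j)
        ≈⟨ +-cong (*-cong (m-fromℕ< a<N j<N) (m-fromℕ< a+1<N j+1<N))
                  (-‿cong (*-cong (m-fromℕ< a+1<N j<N) (m-fromℕ< a<N j+1<N))) ⟩
      M A J * M A′ J′ - M A′ J * M A J′
        ≈⟨ diamond A J A′ J′ (toℕ-succ a<N a+1<N) (toℕ-succ j<N j+1<N)
                   (≡.subst₂ ℕ._<_ (≡.sym (Fin.toℕ-fromℕ< a<N)) (≡.sym (Fin.toℕ-fromℕ< j<N)) a<j) ⟩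
      M A A′ * M J J′
        ≈⟨ *-cong (m-fromℕ< a<N a+1<N) (m-fromℕ< j<N j+1<N) ⟨
      m a (suc a) * m j (suc j) ∎

  v : ℕ → Plane
  v zero = 1# , 0#
  v (suc zero) = 0# , m 0 1
  v (suc (suc i)) = next (m i (suc i) ⁻¹) (m i (suc (suc i))) (m (suc i) (suc (suc i))) (v (suc i)) (v i)

  w : ℕ → ℕ → Carrier
  w a b = wedge (v a) (v b)

  m-succ-nonzero : ∀ i → suc i ℕ.< N → ¬ m i (suc i) ≈ 0#
  m-succ-nonzero i i+1<N = m-nonzero (ℕ.<-trans (ℕ.n<1+n i) i+1<N) i+1<N (ℕ.<⇒≢ (ℕ.n<1+n i))

  w-succ : ∀ i → suc i ℕ.< N → w i (suc i) ≈ m i (suc i)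
  w-succ zero _ = wedge-basis (m 0 1)
  w-succ (suc i) i+2<N = begin
    w (suc i) (suc (suc i))                              ≈⟨ wedge-next₁ _ _ _ (v i) (v (suc i)) ⟩
    (m i (suc i) ⁻¹ * m (suc i) (suc (suc i))) * w i (suc i) ≈⟨ *-congˡ (w-succ i i+1<N) ⟩
    (m i (suc i) ⁻¹ * m (suc i) (suc (suc i))) * m i (suc i) ≈⟨ ⁻¹-*-cancelʳ _ (m-succ-nonzero i i+1<N) ⟩
    m (suc i) (suc (suc i))                              ∎
    where i+1<N = ℕ.<-trans (ℕ.n<1+n _) i+2<N

  w-succ² : ∀ i → suc (suc i) ℕ.< N → w i (suc (suc i)) ≈ m i (suc (suc i))
  w-succ² i i+2<N = begin
    w i (suc (suc i))                                    ≈⟨ wedge-next₀ _ _ _ (v i) (v (suc i)) ⟩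
    (m i (suc i) ⁻¹ * m i (suc (suc i))) * w i (suc i)   ≈⟨ *-congˡ (w-succ i i+1<N) ⟩
    (m i (suc i) ⁻¹ * m i (suc (suc i))) * m i (suc i)   ≈⟨ ⁻¹-*-cancelʳ _ (m-succ-nonzero i i+1<N) ⟩
    m i (suc (suc i))                                    ∎
    where i+1<N = ℕ.<-trans (ℕ.n<1+n _) i+2<N

  WedgeRepresented : ℕ → Set ℓ
  WedgeRepresented g = ∀ a b → b ≡ g ℕ.+ a → b ℕ.< N → m a b ≈ w a b

  wedgeRepresented-step : ∀ g → WedgeRepresented (suc g) → WedgeRepresented (suc (suc g)) →
                          WedgeRepresented (suc (suc (suc g)))
  wedgeRepresented-step g rep₁ rep₂ a b ≡.refl j+1<N =
    *-cancelʳ-nonzero (m-nonzero a+1<N j<N a+1≢j) (∙-cancelˡ (m a (suc a) * m j (suc j)) _ _ (begin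
      m a (suc a) * m j (suc j) + m a (suc j) * m (suc a) j  ≈⟨ m-diamond a<j j+1<N ⟨
      m a j * m (suc a) (suc j)
        ≈⟨ *-cong (rep₂ a j ≡.refl j<N) (rep₂ (suc a) (suc j) j+1≡ j+1<N) ⟩
      w a j * w (suc a) (suc j)                             ≈⟨ plücker (v a) (v (suc a)) (v j) (v (suc j)) ⟩
      w a (suc a) * w j (suc j) + w a (suc j) * w (suc a) j
        ≈⟨ +-cong (*-cong (w-succ a a+1<N) (w-succ j j+1<N)) (*-congˡ (sym (rep₁ (suc a) j j≡ j<N))) ⟩
      m a (suc a) * m j (suc j) + w a (suc j) * m (suc a) j ∎))
    where
    j = suc (suc (g ℕ.+ a))
    j≡ : j ≡ suc g ℕ.+ suc a
    j≡ = ≡.cong suc (≡.sym (ℕ.+-suc g a))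
    j+1≡ : suc j ≡ suc (suc g) ℕ.+ suc a
    j+1≡ = ≡.cong suc j≡
    j<N = ℕ.<-trans (ℕ.n<1+n j) j+1<N
    a<j : a ℕ.< j
    a<j = s≤s (ℕ.m≤n⇒m≤1+n (ℕ.m≤n+m a g))
    a+1<N = ℕ.≤-<-trans a<j j<N
    a+1≢j : suc a ≢ j
    a+1≢j eq = ℕ.<-irrefl eq (s≤s (s≤s (ℕ.m≤n+m a g)))

  wedgeRepresented : ∀ g → WedgeRepresented (suc g) × WedgeRepresented (suc (suc g))
  wedgeRepresented zero = (λ { a .(suc a) ≡.refl a+1<N → sym (w-succ a a+1<N) })
                        , (λ { a .(suc (suc a)) ≡.refl a+2<N → sym (w-succ² a a+2<N) })
  wedgeRepresented (suc g) with wedgeRepresented g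
  ... | rep₁ , rep₂ = rep₂ , wedgeRepresented-step g rep₁ rep₂

  M≈wedge : ∀ {x y : Fin N} → x Fin.≤ y → M x y ≈ w (toℕ x) (toℕ y)
  M≈wedge {x} {y} x≤y = trans (sym (m-toℕ x y)) (represented (toℕ y ℕ.∸ toℕ x) (≡.sym (ℕ.m∸n+n≡m x≤y)))
    where
    represented : ∀ g → toℕ y ≡ g ℕ.+ toℕ x → m (toℕ x) (toℕ y) ≈ w (toℕ x) (toℕ y)
    represented zero y≡x rewrite y≡x = trans (m-diag (Fin.toℕ<n x)) (sym (wedge-self (v (toℕ x))))
    represented (suc g) y≡g+x = proj₁ (wedgeRepresented g) (toℕ x) (toℕ y) y≡g+x (Fin.toℕ<n y)

  ptolemy : ∀ {p q r s : Fin N} → p Fin.≤ q → q Fin.≤ r → r Fin.≤ s →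
            M p r * M q s ≈ M p q * M r s + M p s * M q r
  ptolemy {p} {q} {r} {s} p≤q q≤r r≤s = begin
    M p r * M q s                  ≈⟨ *-cong (M≈wedge p≤r) (M≈wedge q≤s) ⟩
    w (toℕ p) (toℕ r) * w (toℕ q) (toℕ s)
                                   ≈⟨ plücker (v (toℕ p)) (v (toℕ q)) (v (toℕ r)) (v (toℕ s)) ⟩
    w (toℕ p) (toℕ q) * w (toℕ r) (toℕ s) + w (toℕ p) (toℕ s) * w (toℕ q) (toℕ r)
      ≈⟨ +-cong (*-cong (M≈wedge p≤q) (M≈wedge r≤s)) (*-cong (M≈wedge p≤s) (M≈wedge q≤r)) ⟨
    M p q * M r s + M p s * M q r  ∎
    where
    p≤r = ℕ.≤-trans p≤q q≤r
    q≤s = ℕ.≤-trans q≤r r≤s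
    p≤s = ℕ.≤-trans p≤r r≤s

  rowAbove : Fin k → Fin N
  rowAbove i = suc (inject₁ i)

  rowAbove<row : ∀ i → rowAbove i Fin.< suc (suc i)
  rowAbove<row i = s≤s (s≤s (ℕ.≤-reflexive (Fin.toℕ-inject₁ i)))

  M₀-rowAbove-inverse : ∀ i → M zero (rowAbove i) * M zero (rowAbove i) ⁻¹ ≈ 1#
  M₀-rowAbove-inverse i = ⁻¹-inverse _ λ M₀ₛ≈0 → 0≢rowAbove (zero⇒diag _ _ M₀ₛ≈0)
    where
    0≢rowAbove : zero ≢ rowAbove i
    0≢rowAbove ()

  -- Scaled by m₀ₛ, the row operation of T-row is the Ptolemy expression
  -- m₀ₛ mᵣⱼ − m₀ᵣ mₛⱼ − mₛᵣ m₀ⱼ.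
  factor-inverse : ∀ {x u} → x * u ≈ 1# → ∀ a b c d e →
                   a + (- (b * u)) * c + (- (d * u)) * e ≈ u * (x * a - b * c - d * e)
  factor-inverse {x} {u} xu≈1 a b c d e = begin
    a + (- (b * u)) * c + (- (d * u)) * e                        ≈⟨ expand x u a b c d e ⟩
    u * (x * a - b * c - d * e) + (1# - x * u) * a              ≈⟨ +-congˡ (*-congʳ (+-congˡ (-‿cong xu≈1))) ⟩
    u * (x * a - b * c - d * e) + (1# - 1#) * a                 ≈⟨ +-congˡ (trans (*-congʳ (-‿inverseʳ 1#)) (zeroˡ a)) ⟩
    u * (x * a - b * c - d * e) + 0#                            ≈⟨ +-identityʳ _ ⟩
    u * (x * a - b * c - d * e)                                 ∎
    where
    expand : ∀ x u a b c d e → a + (- (b * u)) * c + (- (d * u)) * e ≈ u * (x * a - b * c - d * e) + (1# - x * u) * a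
    expand = solve 7 (λ x u a b c d e → a :+ (:- (b :* u)) :* c :+ (:- (d :* u)) :* e
                                      := u :* (x :* a :- b :* c :- d :* e) :+ (con (ℤ.+ 1) :- x :* u) :* a) refl

  T-row : ∀ (i : Fin k) j → let r = suc (suc i) ; s = rowAbove i ; u = M zero s ⁻¹ in
          T M r j ≈ M r j + (- (M zero r * u)) * M s j + (- (M s r * u)) * M zero j
  T-row i j with toℕ j ℕ.<? toℕ (suc (suc i))
  ... | yes j<r = sym (begin
    M r j + (- (M zero r * u)) * M s j + (- (M s r * u)) * M zero j   ≈⟨ factor-inverse (M₀-rowAbove-inverse i) _ _ _ _ _ ⟩
    u * (M zero s * M r j - M zero r * M s j - M s r * M zero j)
      ≈⟨ *-congˡ (+-congʳ (+-cong (*-congˡ (symmetric r j)) (-‿cong (*-congˡ (symmetric s j))))) ⟩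
    u * (M zero s * M j r - M zero r * M j s - M s r * M zero j)
      ≈⟨ *-congˡ (+-congʳ (+-congʳ (ptolemy z≤n j≤s (ℕ.<⇒≤ (rowAbove<row i))))) ⟩
    u * ((M zero j * M s r + M zero r * M j s) - M zero r * M j s - M s r * M zero j)
      ≈⟨ *-congˡ (cancel _ _ _ _) ⟩
    u * 0#                                                             ≈⟨ zeroʳ u ⟩
    0#                                                                 ∎)
    where
    r = suc (suc i) ; s = rowAbove i ; u = M zero s ⁻¹
    j≤s : j Fin.≤ s
    j≤s = ≡.subst (toℕ j ℕ.≤_) (≡.cong suc (≡.sym (Fin.toℕ-inject₁ i))) (ℕ.s≤s⁻¹ j<r)
    cancel : ∀ a b c d → (a * b + c * d) - c * d - b * a ≈ 0#
    cancel = solve 4 (λ a b c d → (a :* b :+ c :* d) :- c :* d :- b :* a := con (ℤ.+ 0)) refl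
  ... | no j≮r = sym (begin
    M r j + (- (M zero r * u)) * M s j + (- (M s r * u)) * M zero j   ≈⟨ factor-inverse (M₀-rowAbove-inverse i) _ _ _ _ _ ⟩
    u * (M zero s * M r j - M zero r * M s j - M s r * M zero j)
      ≈⟨ *-congˡ (+-congʳ (+-congˡ (-‿cong (ptolemy z≤n (ℕ.<⇒≤ (rowAbove<row i)) (ℕ.≮⇒≥ j≮r))))) ⟩
    u * (M zero s * M r j - (M zero s * M r j + M zero j * M s r) - M s r * M zero j)
      ≈⟨ collect _ _ _ _ _ ⟩
    ((- ((1# + 1#) * M zero j)) * u) * M s r                           ∎)
    where
    r = suc (suc i) ; s = rowAbove i ; u = M zero s ⁻¹
    collect : ∀ u a b c d → u * (a * b - (a * b + c * d) - d * c) ≈ ((- ((1# + 1#) * c)) * u) * d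
    collect = solve 5 (λ u a b c d → u :* (a :* b :- (a :* b :+ c :* d) :- d :* c)
                                   := ((:- (con (ℤ.+ 2) :* c)) :* u) :* d) refl

  reduced : Matrix N
  reduced i = T M (swap₀₁ i)

  reduced-rows : ∀ r → (∀ j → M r j ≈ reduced r j) ⊎ AddsRowsAbove M reduced r
  reduced-rows zero = inj₁ λ _ → refl
  reduced-rows (suc zero) = inj₁ λ _ → refl
  reduced-rows (suc (suc i)) = inj₂ record
    { p = rowAbove i ; q = zero ; p<r = rowAbove<row i ; q<r = s≤s z≤n ; row = T-row i }

proposition2p3 : ∀ {c ℓ c' ℓ'} (R : CommutativeRing c ℓ) → IsIntegralDomain R → CharZero R →
                 (K : Field c' ℓ') (ι : CommutativeRing.Carrier R → Field.Carrier K) →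
                 IsFractionField R K ι →
                 (k : ℕ) (M : MatrixOver.Matrix K (suc (suc k))) → MatrixOver.IsFrieze K M →
                 MatrixOver.RowEquivalent K M (MatrixOver.T K M) ×
                 Field._≈_ K (MatrixOver.det K (MatrixOver.T K M)) (Field.-_ K (MatrixOver.det K M))
proposition2p3 _ _ _ K _ _ k M frieze =
  rowEquiv-trans {A = M} (proj₁ reduction) (rowEquiv-swap₀₁ {A = reduced} T≈reduced∘swap) ,
  trans (det-swap₀₁ {A = reduced} T≈reduced∘swap) (-‿cong (proj₂ reduction))
  where
  open Field K using (_≈_; trans; reflexive; -‿cong)
  open MatrixOver K using (T)
  open Matrices K
  open FriezeMatrix K k M frieze using (reduced; reduced-rows)
  reduction : SpecialRowEquivalent M reduced
  reduction = special-addRowsAbove {A = M} {B = reduced} reduced-rows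
  T≈reduced∘swap : ∀ i j → T M i j ≈ reduced (swap₀₁ i) j
  T≈reduced∘swap i j = reflexive (≡.cong (λ x → T M x j) (≡.sym (swap₀₁-involutive i)))
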